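{- For every default theory $\Delta$ there is a prerequisite-free default theory $\Delta'$ with $\mathrm{ext}(\Delta')=\mathrm{ext}(\Delta)$. Moreover, if $\Delta$ is normal, then such a $\Delta'$ can be chosen to be normal as well.
   Context: $\mathcal L$ is the set of formulas of a propositional language over a denumerable set of atoms; $Cn$ denotes propositional consequence, and a theory is a subset of $\mathcal L$ closed under $Cn$. A default is an expression $d=\frac{\alpha:\Gamma}{\beta}$ with $\alpha,\beta\in\mathcal L$ and $\Gamma$ a finite subset of $\mathcal L$; write $p(d)=\alpha$ (prerequisite), $j(d)=\Gamma$ (justifications), $c(d)=\beta$ (consequent). The default $d$ is prerequisite-free if $p(d)$ is a tautology, and normal if it has the form $\frac{\alpha:\beta}{\beta}$. A default theory is a pair $(D,W)$ with $D$ a set of defaults and $W\subseteq\mathcal L$; it is prerequisite-free (normal) if all defaults in $D$ are. For a theory $S$, a default $d$ is $S$-applicable if $S\not\vdash\neg\gamma$ for every $\gamma\in j(d)$. The reduct $D_S$ is the set of monotone inference rules $\frac{p(d)}{c(d)}$ for $S$-applicable $d\in D$, and $Cn^{D_S}(W)$ is the set of formulas provable from $W$ in propositional calculus extended by the rules in $D_S$. A theory $S$ is an extension of $(D,W)$ iff $S=Cn^{D_S}(W)$; $\mathrm{ext}(D,W)$ denotes the family of all extensions. -}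

module Defs where

open import Data.Nat using (ℕ)
open import Data.Bool using (Bool; true; false; not; _∧_; _∨_)
open import Data.List using (List; []; _∷_)
open import Data.List.Membership.Propositional using (_∈_)
open import Data.Product using (Σ; _×_; _,_)
open import Relation.Binary.PropositionalEquality using (_≡_)
open import Relation.Nullary using (¬_)
open import Function.Bundles using (_⇔_)

data Form : Set where
  atom : ℕ → Form
  ⊥'   : Form
  ¬'_  : Form → Form
  _∧'_ : Form → Form → Form
  _∨'_ : Form → Form → Form
  _⇒'_ : Form → Form → Form

Valuation : Set
Valuation = ℕ → Bool

⟦_⟧ : Form → Valuation → Bool
⟦ atom n ⟧ v = v n
⟦ ⊥' ⟧ v = false
⟦ ¬' φ ⟧ v = not (⟦ φ ⟧ v)
⟦ φ ∧' ψ ⟧ v = ⟦ φ ⟧ v ∧ ⟦ ψ ⟧ v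
⟦ φ ∨' ψ ⟧ v = ⟦ φ ⟧ v ∨ ⟦ ψ ⟧ v
⟦ φ ⇒' ψ ⟧ v = not (⟦ φ ⟧ v) ∨ ⟦ ψ ⟧ v

-- Propositional consequence from a finite set of premises
-- (sound and complete for propositional calculus).
_⊨_ : List Form → Form → Set
Γ ⊨ φ = (v : Valuation) → ((ψ : Form) → ψ ∈ Γ → ⟦ ψ ⟧ v ≡ true) → ⟦ φ ⟧ v ≡ true

Tautology : Form → Set
Tautology φ = [] ⊨ φ

FormSet : Set₁
FormSet = Form → Set

record Default : Set where
  constructor _∶_/_
  field
    pre  : Form
    just : List Form
    cons : Form
open Default public

record DefaultTheory : Set₁ where
  constructor ⟨_,_⟩
  field
    D : Default → Set
    W : FormSet
open DefaultTheory public

PrereqFreeDefault : Default → Set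
PrereqFreeDefault d = Tautology (pre d)

NormalDefault : Default → Set
NormalDefault d = ((γ : Form) → γ ∈ just d → γ ≡ cons d) × (cons d ∈ just d)

PrereqFree : DefaultTheory → Set
PrereqFree Δ = (d : Default) → D Δ d → PrereqFreeDefault d

Normal : DefaultTheory → Set
Normal Δ = (d : Default) → D Δ d → NormalDefault d

Applicable : FormSet → Default → Set
Applicable S d = (γ : Form) → γ ∈ just d → ¬ S (¬' γ)

data CnRed (Δ : DefaultTheory) (S : FormSet) : Form → Set where
  hyp  : {φ : Form} → W Δ φ → CnRed Δ S φ
  cn   : (Γ : List Form) {φ : Form} →
         ((ψ : Form) → ψ ∈ Γ → CnRed Δ S ψ) → Γ ⊨ φ → CnRed Δ S φ
  rule : (d : Default) → D Δ d → Applicable S d →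
         CnRed Δ S (pre d) → CnRed Δ S (cons d)

IsExtension : DefaultTheory → FormSet → Set
IsExtension Δ S = (φ : Form) → S φ ⇔ CnRed Δ S φ

SameExtensions : DefaultTheory → DefaultTheory → Set₁
SameExtensions Δ Δ' = (S : FormSet) → IsExtension Δ S ⇔ IsExtension Δ' S

-- A formula in the closure of the reduct D_S has a derivation using finitely many
-- defaults, whose justifications form a list J consistent with S. Compiling every
-- such derivation of φ into the single default ⊤ : J / φ yields a prerequisite-free
-- theory whose reduct closure agrees with the original one for every S.
-- For a normal theory only defaults ⊤ : ψ / ψ are allowed, so we compile just the
-- formulas ψ derivable with justifications that ψ itself entails. An application of
-- α : β / β is then simulated by ⊤ : a ∧ β / a ∧ β for a self-justifying a ∈ S
-- entailing α; since S is deductively closed and contains a, a ∧ β is consistent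
-- with S exactly when β is.
module Submission where

open import Defs
open import Data.Bool using (true; false; not; _∧_)
open import Data.List using (List; []; _∷_; _++_)
open import Data.List.Relation.Unary.Any using (here; there)
open import Data.List.Membership.Propositional using (_∈_)
open import Data.List.Membership.Propositional.Properties using (∈-++⁻)
open import Data.List.Relation.Binary.Subset.Propositional using (_⊆_)
open import Data.List.Relation.Binary.Subset.Propositional.Properties
  using (xs⊆xs++ys; xs⊆ys++xs; xs⊆x∷xs)
open import Data.Product using (Σ; Σ-syntax; _×_; _,_; proj₁; proj₂)
open import Data.Sum using ([_,_])
open import Function using (_∘_)
open import Function.Bundles using (mk⇔; Equivalence)
open import Relation.Binary.PropositionalEquality using (_≡_; refl; subst)
open import Relation.Nullary using (¬_)
open Equivalence using (to; from)

⊤' : Form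
⊤' = ¬' ⊥'

⊤'-valid : [] ⊨ ⊤'
⊤'-valid _ _ = refl

⊨-assumption : {Γ : List Form} {ψ : Form} → ψ ∈ Γ → Γ ⊨ ψ
⊨-assumption m _ h = h _ m

⊨-cut : {Γ Γ' : List Form} {φ : Form} →
        ((ψ : Form) → ψ ∈ Γ → Γ' ⊨ ψ) → Γ ⊨ φ → Γ' ⊨ φ
⊨-cut hs e v h = e v (λ ψ m → hs ψ m v h)

⊨-trans : {a b γ : Form} → (a ∷ []) ⊨ b → (b ∷ []) ⊨ γ → (a ∷ []) ⊨ γ
⊨-trans {γ = γ} e f = ⊨-cut {φ = γ} (λ { _ (here refl) → e }) f

∧-true : ∀ x y → x ∧ y ≡ true → x ≡ true × y ≡ true
∧-true true  true  _ = refl , refl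
∧-true true  false ()
∧-true false _     ()

∧'-intro : {a b : Form} → (a ∷ b ∷ []) ⊨ (a ∧' b)
∧'-intro {a} {b} v h
  rewrite h a (here refl) | h b (there (here refl)) = refl

∧'-elimˡ : {a b : Form} → ((a ∧' b) ∷ []) ⊨ a
∧'-elimˡ {a} {b} v h with ∧-true (⟦ a ⟧ v) (⟦ b ⟧ v) (h _ (here refl))
... | ta , _ = ta

∧'-elimʳ : {a b : Form} → ((a ∧' b) ∷ []) ⊨ b
∧'-elimʳ {a} {b} v h with ∧-true (⟦ a ⟧ v) (⟦ b ⟧ v) (h _ (here refl))
... | _ , tb = tb

contraposition : {ψ γ : Form} → (ψ ∷ []) ⊨ γ → ((¬' γ) ∷ []) ⊨ (¬' ψ)
contraposition {ψ} {γ} e v h with ⟦ ψ ⟧ v in eq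
... | false = refl
... | true  with () ← subst (λ b → not b ≡ true)
                        (e v (λ { _ (here refl) → eq })) (h _ (here refl))

¬'∧'-resolve : {a b : Form} → (a ∷ (¬' (a ∧' b)) ∷ []) ⊨ (¬' b)
¬'∧'-resolve {a} {b} v h with h a (here refl) | h _ (there (here refl))
... | ta | tnab rewrite ta with ⟦ b ⟧ v
... | true  = tnab
... | false = refl

DeductivelyClosed : FormSet → Set
DeductivelyClosed S =
  (Γ : List Form) {φ : Form} → ((ψ : Form) → ψ ∈ Γ → S ψ) → Γ ⊨ φ → S φ

module _ {S : FormSet} (closed : DeductivelyClosed S) where

  closed-⊤' : S ⊤'
  closed-⊤' = closed [] (λ _ ()) ⊤'-valid

  closed-∧' : {a b : Form} → S a → S b → S (a ∧' b)
  closed-∧' sa sb = closed (_ ∷ _ ∷ []) (λ { _ (here refl) → sa ; _ (there (here refl)) → sb }) ∧'-intro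

  closed-consistent-∧' : {a b : Form} → S a → ¬ S (¬' b) → ¬ S (¬' (a ∧' b))
  closed-consistent-∧' sa s⊬¬b s¬ab =
    s⊬¬b (closed (_ ∷ _ ∷ []) (λ { _ (here refl) → sa ; _ (there (here refl)) → s¬ab }) ¬'∧'-resolve)

  closed-consistent-⊨ : {ψ γ : Form} → (ψ ∷ []) ⊨ γ → ¬ S (¬' ψ) → ¬ S (¬' γ)
  closed-consistent-⊨ e s⊬¬ψ s¬γ = s⊬¬ψ (closed (_ ∷ []) (λ { _ (here refl) → s¬γ }) (contraposition e))

extension-closed : {Δ : DefaultTheory} {S : FormSet} → IsExtension Δ S → DeductivelyClosed S
extension-closed e Γ all ent = from (e _) (cn Γ (λ ψ m → to (e ψ) (all ψ m)) ent)

CnRed-⊤' : {Δ : DefaultTheory} {S : FormSet} → CnRed Δ S ⊤'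
CnRed-⊤' = cn [] (λ _ ()) ⊤'-valid

sameExtensions-criterion : {Δ₁ Δ₂ : DefaultTheory} →
  ({S : FormSet} → DeductivelyClosed S → {φ : Form} → CnRed Δ₁ S φ → CnRed Δ₂ S φ) →
  ({S : FormSet} → DeductivelyClosed S → ({φ : Form} → CnRed Δ₁ S φ → S φ) →
     {φ : Form} → CnRed Δ₂ S φ → CnRed Δ₁ S φ) →
  SameExtensions Δ₁ Δ₂
sameExtensions-criterion {Δ₁} {Δ₂} sound complete S = mk⇔ forth back
  where
  forth : IsExtension Δ₁ S → IsExtension Δ₂ S
  forth e φ = mk⇔ (sound closed ∘ to (e φ)) (from (e φ) ∘ complete closed (from (e _)))
    where
    closed : DeductivelyClosed S
    closed = extension-closed e
  back : IsExtension Δ₂ S → IsExtension Δ₁ S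
  back e φ = mk⇔ (complete closed (from (e _) ∘ sound closed) ∘ to (e φ)) (from (e φ) ∘ sound closed)
    where
    closed : DeductivelyClosed S
    closed = extension-closed e

module _ (Δ : DefaultTheory) where

  data Derivable (J : List Form) : Form → Set where
    hyp  : {φ : Form} → W Δ φ → Derivable J φ
    cn   : (Γ : List Form) {φ : Form} →
           ((ψ : Form) → ψ ∈ Γ → Derivable J ψ) → Γ ⊨ φ → Derivable J φ
    rule : (d : Default) → D Δ d → just d ⊆ J →
           Derivable J (pre d) → Derivable J (cons d)

  derivable-mono : {J J' : List Form} → J ⊆ J' → {φ : Form} → Derivable J φ → Derivable J' φ
  derivable-mono J⊆J' (hyp w)          = hyp w
  derivable-mono J⊆J' (cn Γ ds e)      = cn Γ (λ ψ m → derivable-mono J⊆J' (ds ψ m)) e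
  derivable-mono J⊆J' (rule d d∈D j p) = rule d d∈D (J⊆J' ∘ j) (derivable-mono J⊆J' p)

  Admissible : FormSet → List Form → Set
  Admissible S J = (γ : Form) → γ ∈ J → ¬ S (¬' γ)

  admissible-++ : {S : FormSet} {J J' : List Form} →
                  Admissible S J → Admissible S J' → Admissible S (J ++ J')
  admissible-++ {J = J} a a' γ m = [ a γ , a' γ ] (∈-++⁻ J m)

  derivable⇒CnRed : {S : FormSet} {J : List Form} → Admissible S J →
                    {φ : Form} → Derivable J φ → CnRed Δ S φ
  derivable⇒CnRed adm (hyp w)          = hyp w
  derivable⇒CnRed adm (cn Γ ds e)      = cn Γ (λ ψ m → derivable⇒CnRed adm (ds ψ m)) e
  derivable⇒CnRed adm (rule d d∈D j p) = rule d d∈D (λ γ → adm γ ∘ j) (derivable⇒CnRed adm p)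

  AdmissiblyDerivable : FormSet → Form → Set
  AdmissiblyDerivable S φ = Σ[ J ∈ List Form ] Admissible S J × Derivable J φ

  admissiblyDerivable-all : {S : FormSet} (Γ : List Form) →
    ((ψ : Form) → ψ ∈ Γ → AdmissiblyDerivable S ψ) →
    Σ[ J ∈ List Form ] Admissible S J × ((ψ : Form) → ψ ∈ Γ → Derivable J ψ)
  admissiblyDerivable-all [] _ = [] , (λ _ ()) , (λ _ ())
  admissiblyDerivable-all {S} (x ∷ Γ) h
    with h x (here refl) | admissiblyDerivable-all {S} Γ (λ ψ → h ψ ∘ there)
  ... | J , adm , dx | J' , adm' , dΓ =
    J ++ J' , admissible-++ {S} adm adm' ,
    λ { _ (here refl) → derivable-mono (xs⊆xs++ys J J') dx
      ; ψ (there m)   → derivable-mono (xs⊆ys++xs J' J) (dΓ ψ m) }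

  CnRed⇒admissiblyDerivable : {S : FormSet} {φ : Form} → CnRed Δ S φ → AdmissiblyDerivable S φ
  CnRed⇒admissiblyDerivable (hyp w) = [] , (λ _ ()) , hyp w
  CnRed⇒admissiblyDerivable {S} (cn Γ cs e)
    with admissiblyDerivable-all {S} Γ (λ ψ m → CnRed⇒admissiblyDerivable (cs ψ m))
  ... | J , adm , ds = J , adm , cn Γ ds e
  CnRed⇒admissiblyDerivable {S} (rule d d∈D app p) with CnRed⇒admissiblyDerivable p
  ... | J , adm , dp =
    just d ++ J , admissible-++ {S} app adm ,
    rule d d∈D (xs⊆xs++ys (just d) J) (derivable-mono (xs⊆ys++xs J (just d)) dp)

  data Compiled : Default → Set where
    compile : {J : List Form} {φ : Form} → Derivable J φ → Compiled (⊤' ∶ J / φ)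

  compiled : DefaultTheory
  compiled = ⟨ Compiled , W Δ ⟩

  compiled-prereqFree : PrereqFree compiled
  compiled-prereqFree _ (compile _) = ⊤'-valid

  compiled-sound : {S : FormSet} {φ : Form} → CnRed compiled S φ → CnRed Δ S φ
  compiled-sound (hyp w)                  = hyp w
  compiled-sound (cn Γ cs e)              = cn Γ (λ ψ m → compiled-sound (cs ψ m)) e
  compiled-sound (rule _ (compile d) app _) = derivable⇒CnRed app d

  compiled-complete : {S : FormSet} {φ : Form} → CnRed Δ S φ → CnRed compiled S φ
  compiled-complete c with CnRed⇒admissiblyDerivable c
  ... | J , adm , d = rule (⊤' ∶ J / _) (compile d) adm CnRed-⊤'

  compiled-sameExtensions : SameExtensions compiled Δ
  compiled-sameExtensions =
    sameExtensions-criterion (λ _ → compiled-sound) (λ _ _ → compiled-complete)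

  SelfJustifying : Form → Set
  SelfJustifying ψ = Σ[ J ∈ List Form ] Derivable J ψ × ((γ : Form) → γ ∈ J → (ψ ∷ []) ⊨ γ)

  selfJustifying-⊤' : SelfJustifying ⊤'
  selfJustifying-⊤' = [] , cn [] (λ _ ()) ⊤'-valid , (λ _ ())

  selfJustifying-hyp : {φ : Form} → W Δ φ → SelfJustifying φ
  selfJustifying-hyp w = [] , hyp w , (λ _ ())

  selfJustifying-∧' : {a b : Form} → SelfJustifying a → SelfJustifying b → SelfJustifying (a ∧' b)
  selfJustifying-∧' {a} {b} (J , da , ea) (J' , db , eb) =
    J ++ J' ,
    cn (a ∷ b ∷ [])
       (λ { _ (here refl) → derivable-mono (xs⊆xs++ys J J') da
          ; _ (there (here refl)) → derivable-mono (xs⊆ys++xs J' J) db })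
       ∧'-intro ,
    λ γ m → [ (λ m → ⊨-trans {γ = γ} (∧'-elimˡ {a} {b}) (ea γ m))
            , (λ m → ⊨-trans {γ = γ} (∧'-elimʳ {a} {b}) (eb γ m)) ] (∈-++⁻ J m)

  selfJustifying-rule : {a : Form} {d : Default} → D Δ d → NormalDefault d →
    SelfJustifying a → (a ∷ []) ⊨ pre d → SelfJustifying (a ∧' cons d)
  selfJustifying-rule {a} {d} d∈D (just≡cons , _) (J , da , ea) a⊨pre =
    cons d ∷ J ,
    cn (a ∷ cons d ∷ [])
       (λ { _ (here refl) → da' ; _ (there (here refl)) → dβ })
       ∧'-intro ,
    λ { _ (here refl) → ∧'-elimʳ {a} {cons d}
      ; γ (there m)   → ⊨-trans {γ = γ} (∧'-elimˡ {a} {cons d}) (ea γ m) }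
    where
    da' : Derivable (cons d ∷ J) a
    da' = derivable-mono (xs⊆x∷xs J (cons d)) da
    dβ : Derivable (cons d ∷ J) (cons d)
    dβ = rule d d∈D (λ {γ} m → here (just≡cons γ m)) (cn (a ∷ []) (λ { _ (here refl) → da' }) a⊨pre)

  data NormalCompiled : Default → Set where
    compile : {ψ : Form} → SelfJustifying ψ → NormalCompiled (⊤' ∶ ψ ∷ [] / ψ)

  normalCompiled : DefaultTheory
  normalCompiled = ⟨ NormalCompiled , W Δ ⟩

  normalCompiled-prereqFree : PrereqFree normalCompiled
  normalCompiled-prereqFree _ (compile _) = ⊤'-valid

  normalCompiled-normal : Normal normalCompiled
  normalCompiled-normal _ (compile _) = (λ { _ (here refl) → refl }) , here refl

  Supported : FormSet → Form → Set
  Supported S φ = Σ[ a ∈ Form ] S a × SelfJustifying a × (a ∷ []) ⊨ φ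

  module _ {S : FormSet} (closed : DeductivelyClosed S) where

    normalCompiled-sound : {φ : Form} → CnRed normalCompiled S φ → CnRed Δ S φ
    normalCompiled-sound (hyp w)     = hyp w
    normalCompiled-sound (cn Γ cs e) = cn Γ (λ ψ m → normalCompiled-sound (cs ψ m)) e
    normalCompiled-sound (rule _ (compile (J , d , e)) app _) =
      derivable⇒CnRed (λ γ m → closed-consistent-⊨ closed (e γ m) (app _ (here refl))) d

    supported-all : (Γ : List Form) → ((ψ : Form) → ψ ∈ Γ → Supported S ψ) →
      Σ[ a ∈ Form ] S a × SelfJustifying a × ((ψ : Form) → ψ ∈ Γ → (a ∷ []) ⊨ ψ)
    supported-all [] _ = ⊤' , closed-⊤' closed , selfJustifying-⊤' , (λ _ ())
    supported-all (x ∷ Γ) h with h x (here refl) | supported-all Γ (λ ψ → h ψ ∘ there)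
    ... | a , sa , ja , a⊨x | b , sb , jb , b⊨Γ =
      a ∧' b , closed-∧' closed sa sb , selfJustifying-∧' ja jb ,
      λ { _ (here refl) → ⊨-trans {γ = x} (∧'-elimˡ {a} {b}) a⊨x
        ; ψ (there m)   → ⊨-trans {γ = ψ} (∧'-elimʳ {a} {b}) (b⊨Γ ψ m) }

    supported-cn : (Γ : List Form) {φ : Form} →
      ((ψ : Form) → ψ ∈ Γ → Supported S ψ) → Γ ⊨ φ → Supported S φ
    supported-cn Γ {φ} h e with supported-all Γ h
    ... | a , sa , ja , a⊨Γ = a , sa , ja , ⊨-cut {φ = φ} a⊨Γ e

    normalCompiled-complete : Normal Δ → ({φ : Form} → CnRed normalCompiled S φ → S φ) →
      {φ : Form} → CnRed Δ S φ → Supported S φ × CnRed normalCompiled S φ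
    normalCompiled-complete normal sub {φ} (hyp w) =
      (φ , sub (hyp w) , selfJustifying-hyp w , ⊨-assumption {ψ = φ} (here refl)) , hyp w
    normalCompiled-complete normal sub {φ} (cn Γ cs e) =
      supported-cn Γ {φ} (λ ψ m → proj₁ (complete (cs ψ m))) e ,
      cn Γ (λ ψ m → proj₂ (complete (cs ψ m))) e
      where
      complete : {ψ : Form} → CnRed Δ S ψ → Supported S ψ × CnRed normalCompiled S ψ
      complete = normalCompiled-complete normal sub
    normalCompiled-complete normal sub (rule d d∈D app p)
      with normalCompiled-complete normal sub p
    ... | (a , sa , ja , a⊨pre) , _ =
      (ψ , sub cψ , jψ , ∧'-elimʳ {a} {cons d}) ,
      cn (ψ ∷ []) (λ { _ (here refl) → cψ }) (∧'-elimʳ {a} {cons d})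
      where
      ψ : Form
      ψ = a ∧' cons d
      jψ : SelfJustifying ψ
      jψ = selfJustifying-rule d∈D (normal d d∈D) ja a⊨pre
      cψ : CnRed normalCompiled S ψ
      cψ = rule _ (compile jψ)
             (λ { _ (here refl) → closed-consistent-∧' closed sa (app _ (proj₂ (normal d d∈D))) })
             CnRed-⊤'

  normalCompiled-sameExtensions : Normal Δ → SameExtensions normalCompiled Δ
  normalCompiled-sameExtensions normal =
    sameExtensions-criterion normalCompiled-sound
      (λ closed sub → proj₂ ∘ normalCompiled-complete closed normal sub)

mainTheorem1 : ((Δ : DefaultTheory) → Σ DefaultTheory (λ Δ' → PrereqFree Δ' × SameExtensions Δ' Δ))
    × ((Δ : DefaultTheory) → Normal Δ → Σ DefaultTheory (λ Δ' → PrereqFree Δ' × Normal Δ' × SameExtensions Δ' Δ))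
mainTheorem1 =
  (λ Δ → compiled Δ , compiled-prereqFree Δ , compiled-sameExtensions Δ) ,
  (λ Δ normal → normalCompiled Δ , normalCompiled-prereqFree Δ , normalCompiled-normal Δ ,
                normalCompiled-sameExtensions Δ normal)
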